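{- For every integer $r \geq 0$, the $2^r\times 2^r$ matrix $M_r$ indexed by subsets of $[r]=\{1,\ldots,r\}$, with entries $M_r(S,T) = \binom{|S\cap T|}{2} + \binom{|\overline{S}\cap\overline{T}|}{2}$ (where $\overline{S}=[r]\setminus S$), is positive semidefinite.
   Context: $\binom{n}{2} = n(n-1)/2$ for nonnegative integers $n$; $[0]=\emptyset$.
   Formalization: Positive semidefiniteness of $M_r$ is asserted only for test vectors with rational entries, indexed by the subsets of [r]. -}

module Defs where

open import Data.Bool using (Bool; true; false)
open import Data.Nat using (ℕ; zero; suc)
open import Data.Nat.Combinatorics using (_C_)
open import Data.Integer using (+_)
open import Data.Fin.Subset using (Subset; _∩_; ∁; ∣_∣)
open import Data.Vec using ([]; _∷_)
open import Data.List using (List; []; _∷_; map; _++_; foldr)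
open import Data.Rational using (ℚ; 0ℚ; _+_; _*_; _/_)

allSubsets : (r : ℕ) → List (Subset r)
allSubsets zero    = [] ∷ []
allSubsets (suc r) = map (false ∷_) (allSubsets r) ++ map (true ∷_) (allSubsets r)

ℕ→ℚ : ℕ → ℚ
ℕ→ℚ n = + n / 1

sumℚ : {A : Set} → (A → ℚ) → List A → ℚ
sumℚ f = foldr (λ a acc → f a + acc) 0ℚ

M : (r : ℕ) → Subset r → Subset r → ℕ
M r S T = (∣ S ∩ T ∣ C 2) Data.Nat.+ (∣ ∁ S ∩ ∁ T ∣ C 2)

quadForm : (r : ℕ) → (Subset r → ℚ) → ℚ
quadForm r x = sumℚ (λ S → sumℚ (λ T → x S * ℕ→ℚ (M r S T) * x T) (allSubsets r)) (allSubsets r)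

-- Since (n choose 2) counts the 2-subsets of an n-set, C(|S ∩ T|, 2) = Σ_{i<j} [i,j ∈ S][i,j ∈ T]
-- and likewise for the complements. So M_r is the Gram matrix of the 0/1 vectors
-- S ↦ [i,j ∈ S] and S ↦ [i,j ∉ S], and a Gram matrix is positive semidefinite because
-- xᵀ (Σ_f f fᵀ) x = Σ_f (xᵀ f)².
module Submission where

open import Defs
open import Data.Nat using (ℕ)
open import Data.Fin.Subset using (Subset)
open import Data.Rational using (ℚ; 0ℚ; _≤_)

open import Data.Bool using (Bool; true; false; _∧_)
open import Data.Nat as ℕ using (zero; suc)
import Data.Nat.Properties as ℕ
open import Data.Nat.Combinatorics using (_C_; nC1≡n; nCk+nC[k+1]≡[n+1]C[k+1])
open import Data.Nat.Divisibility using (∣1⇒≡1)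
open import Data.Integer as ℤ using (-[1+_])
import Data.Integer.Properties as ℤ
open import Data.Rational using (mkℚ; _+_; _*_; _/_)
open import Data.Rational.Properties
  using ( normalize-coprime; *-zeroˡ; *-zeroʳ; *-distribˡ-+; *-distribʳ-+; +-0-commutativeMonoid
        ; ≤-refl; +-mono-≤; nonNegative⁻¹; nonNeg*nonNeg⇒nonNeg; neg*neg⇒pos; pos⇒nonNeg)
open import Data.Rational.Solver using (module +-*-Solver)
open import Data.Fin.Subset using (_∩_; ∁; ∣_∣)
open import Data.Vec using ([]; _∷_; head; tail)
open import Data.List using (List; []; _∷_; map; _++_)
open import Data.List.Properties using (map-++)
open import Data.Nat.ListAction using (sum)
open import Data.Nat.ListAction.Properties using (sum-++)
open import Data.Product using (_,_)
open import Function using (_∘_)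
open import Relation.Binary.PropositionalEquality
open ≡-Reasoning
open import Algebra.Bundles using (CommutativeMonoid)
open import Algebra.Properties.CommutativeSemigroup (CommutativeMonoid.commutativeSemigroup +-0-commutativeMonoid)
  using () renaming (interchange to +-interchange)
open import Algebra.Properties.CommutativeSemigroup ℕ.*-commutativeSemigroup
  using () renaming (interchange to *-interchange)
open +-*-Solver using (solve; _:=_; _:+_; _:*_)

ℕ→ℚ≡mkℚ : ∀ n → ℕ→ℚ n ≡ mkℚ (ℤ.+ n) 0 (λ (_ , d∣1) → ∣1⇒≡1 d∣1)
ℕ→ℚ≡mkℚ n = normalize-coprime (λ (_ , d∣1) → ∣1⇒≡1 d∣1)

ℕ→ℚ-homo-+ : ∀ m n → ℕ→ℚ (m ℕ.+ n) ≡ ℕ→ℚ m + ℕ→ℚ n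
ℕ→ℚ-homo-+ m n rewrite ℕ→ℚ≡mkℚ m | ℕ→ℚ≡mkℚ n =
  cong (_/ 1) (sym (cong₂ ℤ._+_ (ℤ.*-identityʳ (ℤ.+ m)) (ℤ.*-identityʳ (ℤ.+ n))))

ℕ→ℚ-homo-* : ∀ m n → ℕ→ℚ (m ℕ.* n) ≡ ℕ→ℚ m * ℕ→ℚ n
ℕ→ℚ-homo-* m n rewrite ℕ→ℚ≡mkℚ m | ℕ→ℚ≡mkℚ n = cong (_/ 1) (ℤ.pos-* m n)

0≤p*p : ∀ p → 0ℚ ≤ p * p
0≤p*p p@(mkℚ (ℤ.+ _) _ _)    = nonNegative⁻¹ (p * p) {{nonNeg*nonNeg⇒nonNeg p p}}
0≤p*p p@(mkℚ -[1+ _ ] _ _) = nonNegative⁻¹ (p * p) {{pos⇒nonNeg (p * p) {{neg*neg⇒pos p p}}}}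

module _ {A : Set} where

  sumℚ-cong : {f g : A → ℚ} → (∀ a → f a ≡ g a) → ∀ xs → sumℚ f xs ≡ sumℚ g xs
  sumℚ-cong f≗g []       = refl
  sumℚ-cong f≗g (a ∷ xs) = cong₂ _+_ (f≗g a) (sumℚ-cong f≗g xs)

  sumℚ-zero : ∀ (xs : List A) → sumℚ (λ _ → 0ℚ) xs ≡ 0ℚ
  sumℚ-zero []       = refl
  sumℚ-zero (_ ∷ xs) = cong (0ℚ +_) (sumℚ-zero xs)

  sumℚ-distrib-+ : ∀ (f g : A → ℚ) xs → sumℚ (λ a → f a + g a) xs ≡ sumℚ f xs + sumℚ g xs
  sumℚ-distrib-+ f g []       = refl
  sumℚ-distrib-+ f g (a ∷ xs) = begin
    (f a + g a) + sumℚ (λ a → f a + g a) xs ≡⟨ cong (f a + g a +_) (sumℚ-distrib-+ f g xs) ⟩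
    (f a + g a) + (sumℚ f xs + sumℚ g xs)   ≡⟨ +-interchange (f a) (g a) (sumℚ f xs) (sumℚ g xs) ⟩
    (f a + sumℚ f xs) + (g a + sumℚ g xs)   ∎

  sumℚ-*ˡ : ∀ c (f : A → ℚ) xs → sumℚ (λ a → c * f a) xs ≡ c * sumℚ f xs
  sumℚ-*ˡ c f []       = sym (*-zeroʳ c)
  sumℚ-*ˡ c f (a ∷ xs) =
    trans (cong (c * f a +_) (sumℚ-*ˡ c f xs)) (sym (*-distribˡ-+ c (f a) (sumℚ f xs)))

  sumℚ-*ʳ : ∀ c (f : A → ℚ) xs → sumℚ (λ a → f a * c) xs ≡ sumℚ f xs * c
  sumℚ-*ʳ c f []       = sym (*-zeroˡ c)
  sumℚ-*ʳ c f (a ∷ xs) =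
    trans (cong (f a * c +_) (sumℚ-*ʳ c f xs)) (sym (*-distribʳ-+ c (f a) (sumℚ f xs)))

  sumℚ-nonNeg : {f : A → ℚ} → (∀ a → 0ℚ ≤ f a) → ∀ xs → 0ℚ ≤ sumℚ f xs
  sumℚ-nonNeg 0≤f []       = ≤-refl
  sumℚ-nonNeg 0≤f (a ∷ xs) = +-mono-≤ (0≤f a) (sumℚ-nonNeg 0≤f xs)

module _ {A : Set} where

  quad : List A → (A → A → ℚ) → (A → ℚ) → ℚ
  quad xs K x = sumℚ (λ a → sumℚ (λ b → x a * K a b * x b) xs) xs

  dot : List A → (A → ℚ) → (A → ℚ) → ℚ
  dot xs x u = sumℚ (λ a → x a * u a) xs

  module _ (xs : List A) (x : A → ℚ) where

    quad-cong : {K L : A → A → ℚ} → (∀ a b → K a b ≡ L a b) → quad xs K x ≡ quad xs L x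
    quad-cong K≗L = sumℚ-cong (λ a → sumℚ-cong (λ b → cong (λ k → x a * k * x b) (K≗L a b)) xs) xs

    quad-zero : quad xs (λ _ _ → 0ℚ) x ≡ 0ℚ
    quad-zero = begin
      quad xs (λ _ _ → 0ℚ) x               ≡⟨ sumℚ-cong (λ a → sumℚ-cong (λ b → p*0*q≡0 (x a) (x b)) xs) xs ⟩
      sumℚ (λ _ → sumℚ (λ _ → 0ℚ) xs) xs ≡⟨ sumℚ-cong (λ _ → sumℚ-zero xs) xs ⟩
      sumℚ (λ _ → 0ℚ) xs                  ≡⟨ sumℚ-zero xs ⟩
      0ℚ                                   ∎
      where
      p*0*q≡0 : ∀ p q → p * 0ℚ * q ≡ 0ℚ
      p*0*q≡0 p q = trans (cong (_* q) (*-zeroʳ p)) (*-zeroˡ q)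

    quad-+ : ∀ (K L : A → A → ℚ) → quad xs (λ a b → K a b + L a b) x ≡ quad xs K x + quad xs L x
    quad-+ K L = begin
      quad xs (λ a b → K a b + L a b) x
        ≡⟨ sumℚ-cong (λ a → sumℚ-cong (λ b → distrib (x a) (K a b) (L a b) (x b)) xs) xs ⟩
      sumℚ (λ a → sumℚ (λ b → x a * K a b * x b + x a * L a b * x b) xs) xs
        ≡⟨ sumℚ-cong (λ a → sumℚ-distrib-+ (λ b → x a * K a b * x b) (λ b → x a * L a b * x b) xs) xs ⟩
      sumℚ (λ a → sumℚ (λ b → x a * K a b * x b) xs + sumℚ (λ b → x a * L a b * x b) xs) xs
        ≡⟨ sumℚ-distrib-+ (λ a → sumℚ (λ b → x a * K a b * x b) xs) (λ a → sumℚ (λ b → x a * L a b * x b) xs) xs ⟩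
      quad xs K x + quad xs L x
        ∎
      where
      distrib : ∀ p k l q → p * (k + l) * q ≡ p * k * q + p * l * q
      distrib = solve 4 (λ p k l q → p :* (k :+ l) :* q := p :* k :* q :+ p :* l :* q) refl

    quad-rank₁ : ∀ (u : A → ℚ) → quad xs (λ a b → u a * u b) x ≡ dot xs x u * dot xs x u
    quad-rank₁ u = begin
      quad xs (λ a b → u a * u b) x
        ≡⟨ sumℚ-cong (λ a → sumℚ-cong (λ b → regroup (x a) (u a) (u b) (x b)) xs) xs ⟩
      sumℚ (λ a → sumℚ (λ b → (x a * u a) * (x b * u b)) xs) xs
        ≡⟨ sumℚ-cong (λ a → sumℚ-*ˡ (x a * u a) (λ b → x b * u b) xs) xs ⟩
      sumℚ (λ a → (x a * u a) * dot xs x u) xs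
        ≡⟨ sumℚ-*ʳ (dot xs x u) (λ a → x a * u a) xs ⟩
      dot xs x u * dot xs x u
        ∎
      where
      regroup : ∀ p s t q → p * (s * t) * q ≡ (p * s) * (q * t)
      regroup = solve 4 (λ p s t q → p :* (s :* t) :* q := (p :* s) :* (q :* t)) refl

    quad-gram≡sum-of-squares : ∀ {F : Set} (v : F → A → ℚ) fs →
      quad xs (λ a b → sumℚ (λ f → v f a * v f b) fs) x ≡
      sumℚ (λ f → dot xs x (v f) * dot xs x (v f)) fs
    quad-gram≡sum-of-squares v []       = quad-zero
    quad-gram≡sum-of-squares v (f ∷ fs) = begin
      quad xs (λ a b → v f a * v f b + sumℚ (λ g → v g a * v g b) fs) x
        ≡⟨ quad-+ (λ a b → v f a * v f b) (λ a b → sumℚ (λ g → v g a * v g b) fs) ⟩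
      quad xs (λ a b → v f a * v f b) x + quad xs (λ a b → sumℚ (λ g → v g a * v g b) fs) x
        ≡⟨ cong₂ _+_ (quad-rank₁ (v f)) (quad-gram≡sum-of-squares v fs) ⟩
      dot xs x (v f) * dot xs x (v f) + sumℚ (λ g → dot xs x (v g) * dot xs x (v g)) fs
        ∎

    quad-gram-nonNeg : ∀ {F : Set} (v : F → A → ℚ) fs →
                       0ℚ ≤ quad xs (λ a b → sumℚ (λ f → v f a * v f b) fs) x
    quad-gram-nonNeg v fs = subst (0ℚ ≤_) (sym (quad-gram≡sum-of-squares v fs))
      (sumℚ-nonNeg (λ f → 0≤p*p (dot xs x (v f))) fs)

_·_ : {A : Set} → (A → ℕ) → (A → ℕ) → A → ℕ
(f · g) a = f a ℕ.* g a

infixl 7 _·_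

gram : {A : Set} → List (A → ℕ) → A → A → ℕ
gram fs a b = sum (map (λ f → f a ℕ.* f b) fs)

module _ {A : Set} where

  ℕ→ℚ-gram : ∀ (fs : List (A → ℕ)) a b →
             ℕ→ℚ (gram fs a b) ≡ sumℚ (λ f → ℕ→ℚ (f a) * ℕ→ℚ (f b)) fs
  ℕ→ℚ-gram []       a b = refl
  ℕ→ℚ-gram (f ∷ fs) a b = begin
    ℕ→ℚ (f a ℕ.* f b ℕ.+ gram fs a b)      ≡⟨ ℕ→ℚ-homo-+ (f a ℕ.* f b) (gram fs a b) ⟩
    ℕ→ℚ (f a ℕ.* f b) + ℕ→ℚ (gram fs a b) ≡⟨ cong₂ _+_ (ℕ→ℚ-homo-* (f a) (f b)) (ℕ→ℚ-gram fs a b) ⟩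
    ℕ→ℚ (f a) * ℕ→ℚ (f b) + sumℚ (λ g → ℕ→ℚ (g a) * ℕ→ℚ (g b)) fs ∎

  gram-psd : ∀ (xs : List A) (fs : List (A → ℕ)) (x : A → ℚ) →
             0ℚ ≤ quad xs (λ a b → ℕ→ℚ (gram fs a b)) x
  gram-psd xs fs x = subst (0ℚ ≤_) (sym (quad-cong xs x (ℕ→ℚ-gram fs)))
    (quad-gram-nonNeg xs x (λ f a → ℕ→ℚ (f a)) fs)

  gram-++ : ∀ (fs gs : List (A → ℕ)) a b → gram (fs ++ gs) a b ≡ gram fs a b ℕ.+ gram gs a b
  gram-++ fs gs a b = begin
    sum (map (λ f → f a ℕ.* f b) (fs ++ gs))                         ≡⟨ cong sum (map-++ _ fs gs) ⟩
    sum (map (λ f → f a ℕ.* f b) fs ++ map (λ f → f a ℕ.* f b) gs) ≡⟨ sum-++ (map _ fs) _ ⟩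
    gram fs a b ℕ.+ gram gs a b                                     ∎

  gram-∘ : ∀ {B : Set} (g : B → A) (fs : List (A → ℕ)) a b → gram (map (_∘ g) fs) a b ≡ gram fs (g a) (g b)
  gram-∘ g []       a b = refl
  gram-∘ g (f ∷ fs) a b = cong (f (g a) ℕ.* f (g b) ℕ.+_) (gram-∘ g fs a b)

  gram-· : ∀ (w : A → ℕ) (fs : List (A → ℕ)) a b →
           gram (map (w ·_) fs) a b ≡ w a ℕ.* w b ℕ.* gram fs a b
  gram-· w []       a b = sym (ℕ.*-zeroʳ (w a ℕ.* w b))
  gram-· w (f ∷ fs) a b = begin
    w a ℕ.* f a ℕ.* (w b ℕ.* f b) ℕ.+ gram (map (w ·_) fs) a b
      ≡⟨ cong₂ ℕ._+_ (*-interchange (w a) (f a) (w b) (f b)) (gram-· w fs a b) ⟩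
    w a ℕ.* w b ℕ.* (f a ℕ.* f b) ℕ.+ w a ℕ.* w b ℕ.* gram fs a b
      ≡⟨ sym (ℕ.*-distribˡ-+ (w a ℕ.* w b) (f a ℕ.* f b) (gram fs a b)) ⟩
    w a ℕ.* w b ℕ.* (f a ℕ.* f b ℕ.+ gram fs a b)
      ∎

bit : Bool → ℕ
bit true  = 1
bit false = 0

bit-∧ : ∀ s t → bit (s ∧ t) ≡ bit s ℕ.* bit t
bit-∧ true  true  = refl
bit-∧ true  false = refl
bit-∧ false _     = refl

∣∷∣ : ∀ {r} b (S : Subset r) → ∣ b ∷ S ∣ ≡ bit b ℕ.+ ∣ S ∣
∣∷∣ true  S = refl
∣∷∣ false S = refl

∣∷∩∷∣ : ∀ {r} s t (S T : Subset r) → ∣ (s ∷ S) ∩ (t ∷ T) ∣ ≡ bit s ℕ.* bit t ℕ.+ ∣ S ∩ T ∣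
∣∷∩∷∣ s t S T = trans (∣∷∣ (s ∧ t) (S ∩ T)) (cong (ℕ._+ ∣ S ∩ T ∣) (bit-∧ s t))

[bit+n]C2 : ∀ b n → (bit b ℕ.+ n) C 2 ≡ bit b ℕ.* n ℕ.+ n C 2
[bit+n]C2 false n = refl
[bit+n]C2 true  n = begin
  suc n C 2         ≡⟨ nCk+nC[k+1]≡[n+1]C[k+1] n 1 ⟨
  n C 1 ℕ.+ n C 2   ≡⟨ cong (ℕ._+ n C 2) (trans (nC1≡n n) (sym (ℕ.*-identityˡ n))) ⟩
  1 ℕ.* n ℕ.+ n C 2 ∎

∣∷∩∷∣C2 : ∀ {r} s t (S T : Subset r) →
          ∣ (s ∷ S) ∩ (t ∷ T) ∣ C 2 ≡ bit s ℕ.* bit t ℕ.* ∣ S ∩ T ∣ ℕ.+ ∣ S ∩ T ∣ C 2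
∣∷∩∷∣C2 s t S T = begin
  ∣ (s ∷ S) ∩ (t ∷ T) ∣ C 2                     ≡⟨ cong (_C 2) (∣∷∣ (s ∧ t) (S ∩ T)) ⟩
  (bit (s ∧ t) ℕ.+ ∣ S ∩ T ∣) C 2               ≡⟨ [bit+n]C2 (s ∧ t) ∣ S ∩ T ∣ ⟩
  bit (s ∧ t) ℕ.* ∣ S ∩ T ∣ ℕ.+ ∣ S ∩ T ∣ C 2   ≡⟨ cong (λ b → b ℕ.* ∣ S ∩ T ∣ ℕ.+ ∣ S ∩ T ∣ C 2) (bit-∧ s t) ⟩
  bit s ℕ.* bit t ℕ.* ∣ S ∩ T ∣ ℕ.+ ∣ S ∩ T ∣ C 2 ∎

coordinates : (r : ℕ) → List (Subset r → ℕ)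
coordinates zero    = []
coordinates (suc r) = bit ∘ head ∷ map (_∘ tail) (coordinates r)

-- the indicators S ↦ [i, j ∈ S] of the pairs i < j: either i is the first element, or both lie in the tail
pairs : (r : ℕ) → List (Subset r → ℕ)
pairs zero    = []
pairs (suc r) = map ((bit ∘ head) ·_) (map (_∘ tail) (coordinates r))
             ++ map (_∘ tail) (pairs r)

gram-coordinates : ∀ {r} (S T : Subset r) → gram (coordinates r) S T ≡ ∣ S ∩ T ∣
gram-coordinates []      []      = refl
gram-coordinates {suc r} (s ∷ S) (t ∷ T) = begin
  bit s ℕ.* bit t ℕ.+ gram (map (_∘ tail) (coordinates r)) (s ∷ S) (t ∷ T)
    ≡⟨ cong (bit s ℕ.* bit t ℕ.+_) (gram-∘ tail (coordinates r) (s ∷ S) (t ∷ T)) ⟩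
  bit s ℕ.* bit t ℕ.+ gram (coordinates r) S T
    ≡⟨ cong (bit s ℕ.* bit t ℕ.+_) (gram-coordinates S T) ⟩
  bit s ℕ.* bit t ℕ.+ ∣ S ∩ T ∣
    ≡⟨ ∣∷∩∷∣ s t S T ⟨
  ∣ (s ∷ S) ∩ (t ∷ T) ∣
    ∎

gram-pairs : ∀ {r} (S T : Subset r) → gram (pairs r) S T ≡ ∣ S ∩ T ∣ C 2
gram-pairs []      []      = refl
gram-pairs {suc r} (s ∷ S) (t ∷ T) = begin
  gram (map ((bit ∘ head) ·_) tailCoordinates ++ map (_∘ tail) (pairs r)) (s ∷ S) (t ∷ T)
    ≡⟨ gram-++ (map ((bit ∘ head) ·_) tailCoordinates) (map (_∘ tail) (pairs r)) (s ∷ S) (t ∷ T) ⟩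
  gram (map ((bit ∘ head) ·_) tailCoordinates) (s ∷ S) (t ∷ T) ℕ.+ gram (map (_∘ tail) (pairs r)) (s ∷ S) (t ∷ T)
    ≡⟨ cong₂ ℕ._+_ (gram-· (bit ∘ head) tailCoordinates (s ∷ S) (t ∷ T)) (gram-∘ tail (pairs r) (s ∷ S) (t ∷ T)) ⟩
  bit s ℕ.* bit t ℕ.* gram tailCoordinates (s ∷ S) (t ∷ T) ℕ.+ gram (pairs r) S T
    ≡⟨ cong₂ (λ c p → bit s ℕ.* bit t ℕ.* c ℕ.+ p) gram-tailCoordinates (gram-pairs S T) ⟩
  bit s ℕ.* bit t ℕ.* ∣ S ∩ T ∣ ℕ.+ ∣ S ∩ T ∣ C 2
    ≡⟨ ∣∷∩∷∣C2 s t S T ⟨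
  ∣ (s ∷ S) ∩ (t ∷ T) ∣ C 2
    ∎
  where
  tailCoordinates : List (Subset (suc r) → ℕ)
  tailCoordinates = map (_∘ tail) (coordinates r)

  gram-tailCoordinates : gram tailCoordinates (s ∷ S) (t ∷ T) ≡ ∣ S ∩ T ∣
  gram-tailCoordinates = trans (gram-∘ tail (coordinates r) (s ∷ S) (t ∷ T)) (gram-coordinates S T)

features : (r : ℕ) → List (Subset r → ℕ)
features r = pairs r ++ map (_∘ ∁) (pairs r)

gram-features : ∀ r (S T : Subset r) → gram (features r) S T ≡ M r S T
gram-features r S T = begin
  gram (pairs r ++ map (_∘ ∁) (pairs r)) S T
    ≡⟨ gram-++ (pairs r) (map (_∘ ∁) (pairs r)) S T ⟩
  gram (pairs r) S T ℕ.+ gram (map (_∘ ∁) (pairs r)) S T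
    ≡⟨ cong (gram (pairs r) S T ℕ.+_) (gram-∘ ∁ (pairs r) S T) ⟩
  gram (pairs r) S T ℕ.+ gram (pairs r) (∁ S) (∁ T)
    ≡⟨ cong₂ ℕ._+_ (gram-pairs S T) (gram-pairs (∁ S) (∁ T)) ⟩
  M r S T
    ∎

corollary1 : (r : ℕ) → (x : Subset r → ℚ) → 0ℚ ≤ quadForm r x
corollary1 r x = subst (0ℚ ≤_) (quad-cong (allSubsets r) x (λ S T → cong ℕ→ℚ (gram-features r S T)))
  (gram-psd (allSubsets r) (features r) x)
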